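{- Let $A$ be a set, $n\geq1$, and let $\sim$ be an equivalence relation on a subset $S$ of $A^n$. Let $\mathscr G$ be an $n$-``primitive'' permutation group acting on $A$ and leaving the $\sim$-classes invariant. Then any approximation $\eta$ of $\sim$ which is invariant under $\mathscr G$ and presmooth with respect to $\mathscr G$ is also smooth with respect to $\mathscr G$.
   Context: Permutation groups on $A$ act componentwise on $A^n$. An equivalence relation $\eta$ on a set $S'$ with $S\subseteq S'\subseteq A^n$ is an approximation of $\sim$ if the restriction of $\eta$ to $S$ refines $\sim$ (possibly non-properly). For $\mathscr G$ leaving the $\sim$-classes and $\eta$ invariant, $\eta$ is smooth if every $\sim$-class $C$ intersects some $\eta$-class $C'$ such that $C\cap C'$ contains a whole $\mathscr G$-orbit; presmooth if every $\sim$-class $C$ intersects some $\eta$-class $C'$ such that $C\cap C'$ contains two disjoint tuples (tuples with no common entry) in the same $\mathscr G$-orbit. $\mathscr G$ is $n$-``primitive'' if for every $\mathscr G$-orbit $O\subseteq A^n$, every $\mathscr G$-invariant equivalence relation on $O$ containing a pair $(a,b)$ with $a,b$ disjoint is full. -}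

module Defs where

open import Level using (Level; suc)
open import Data.Nat using (ℕ)
open import Data.Fin using (Fin)
open import Data.Vec using (Vec; map; lookup)
open import Data.Product using (_×_; Σ; ∃; _,_)
open import Function using (_∘_; id)
open import Relation.Binary.PropositionalEquality using (_≡_; _≢_)
open import Relation.Binary.PropositionalEquality using (_≗_)

private variable ℓ : Level

record IsPermGroup {A : Set ℓ} (G : (A → A) → Set ℓ) : Set ℓ where
  field
    id∈    : G id
    ∘∈     : ∀ {g h} → G g → G h → G (g ∘ h)
    inv∈   : ∀ {g} → G g → Σ (A → A) λ h → G h × (h ∘ g ≗ id) × (g ∘ h ≗ id)

_·_ : {A : Set ℓ} {n : ℕ} → (A → A) → Vec A n → Vec A n
g · x = map g x

record IsEquivOn {A : Set ℓ} (P : A → Set ℓ) (R : A → A → Set ℓ) : Set ℓ where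
  field
    reflOn  : ∀ {x} → P x → R x x
    symOn   : ∀ {x y} → P x → P y → R x y → R y x
    transOn : ∀ {x y z} → P x → P y → P z → R x y → R y z → R x z

Disjoint : {A : Set ℓ} {n : ℕ} → Vec A n → Vec A n → Set ℓ
Disjoint x y = ∀ i j → lookup x i ≢ lookup y j

module _ {A : Set ℓ} {n : ℕ} (G : (A → A) → Set ℓ) where

  InOrbit : Vec A n → Vec A n → Set ℓ
  InOrbit o x = Σ (A → A) λ g → G g × (g · o ≡ x)

  -- G is n-"primitive": for every orbit O (= orbit of some o), every
  -- G-invariant equivalence relation on O containing a pair of disjoint
  -- tuples of O is full on O.
  Primitive : Set (suc ℓ)
  Primitive = ∀ (o : Vec A n) (R : Vec A n → Vec A n → Set ℓ) →
    IsEquivOn (InOrbit o) R →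
    (∀ {g x y} → G g → InOrbit o x → InOrbit o y → R x y → R (g · x) (g · y)) →
    (Σ (Vec A n) λ a → Σ (Vec A n) λ b →
       InOrbit o a × InOrbit o b × Disjoint a b × R a b) →
    ∀ {x y} → InOrbit o x → InOrbit o y → R x y

  LeavesClassesInvariant : (Vec A n → Set ℓ) → (Vec A n → Vec A n → Set ℓ) → Set ℓ
  LeavesClassesInvariant S _~_ = ∀ {g x} → G g → S x → S (g · x) × ((g · x) ~ x)

  LeavesInvariant : (Vec A n → Set ℓ) → (Vec A n → Vec A n → Set ℓ) → Set ℓ
  LeavesInvariant S' η = (∀ {g x} → G g → S' x → S' (g · x)) ×
    (∀ {g x y} → G g → S' x → S' y → η x y → η (g · x) (g · y))

  IsApproximation : (S : Vec A n → Set ℓ) (_~_ : Vec A n → Vec A n → Set ℓ)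
                    (S' : Vec A n → Set ℓ) (η : Vec A n → Vec A n → Set ℓ) → Set ℓ
  IsApproximation S _~_ S' η = (∀ {x} → S x → S' x) × IsEquivOn S' η ×
    (∀ {x y} → S x → S y → η x y → x ~ y)

  -- smooth: for every ~-class C (class of a ∈ S) there is an η-class C'
  -- (class of c ∈ S') such that C ∩ C' contains a whole G-orbit (orbit of x).
  Smooth : (S : Vec A n → Set ℓ) (_~_ : Vec A n → Vec A n → Set ℓ)
           (S' : Vec A n → Set ℓ) (η : Vec A n → Vec A n → Set ℓ) → Set ℓ
  Smooth S _~_ S' η = ∀ {a} → S a → Σ (Vec A n) λ c → S' c × Σ (Vec A n) λ x →
    ∀ {y} → InOrbit x y → (S y × y ~ a) × (S' y × η y c)

  -- presmooth: for every ~-class C there is an η-class C' such that C ∩ C'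
  -- contains two disjoint tuples x, y in the same G-orbit.
  Presmooth : (S : Vec A n → Set ℓ) (_~_ : Vec A n → Vec A n → Set ℓ)
              (S' : Vec A n → Set ℓ) (η : Vec A n → Vec A n → Set ℓ) → Set ℓ
  Presmooth S _~_ S' η = ∀ {a} → S a → Σ (Vec A n) λ c → S' c ×
    Σ (Vec A n) λ x → Σ (Vec A n) λ y →
      (S x × x ~ a × S' x × η x c) × (S y × y ~ a × S' y × η y c) ×
      Disjoint x y × InOrbit x y

module Submission where

open import Defs
open import Level using (Level)
open import Data.Nat using (ℕ; _≤_)
open import Data.Vec using (Vec)
open import Data.Vec.Properties using (map-id)
open import Data.Product using (_×_; _,_; proj₁; proj₂)
open import Function using (id)
open import Relation.Binary.PropositionalEquality using (refl)

-- Presmoothness gives disjoint η-related tuples x and y = g · x. Restricted to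
-- the orbit of x, η is a G-invariant equivalence containing this disjoint pair,
-- so by primitivity the whole orbit of x lies in one η-class; it lies in the
-- ~-class of x because G leaves the ~-classes invariant.

module _ {ℓ : Level} {A : Set ℓ} {n : ℕ} (G : (A → A) → Set ℓ) where

  InOrbit-refl : IsPermGroup G → (o : Vec A n) → InOrbit G o o
  InOrbit-refl isPermGroup o = id , IsPermGroup.id∈ isPermGroup , map-id o

  InOrbit-closed : {P : Vec A n → Set ℓ} → (∀ {g x} → G g → P x → P (g · x)) →
                   ∀ {o u} → P o → InOrbit G o u → P u
  InOrbit-closed closed Po (g , Gg , refl) = closed Gg Po

  IsEquivOn-restrict : {P Q : Vec A n → Set ℓ} {R : Vec A n → Vec A n → Set ℓ} →
                       (∀ {x} → Q x → P x) → IsEquivOn P R → IsEquivOn Q R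
  IsEquivOn-restrict Q⊆P isEquiv = record
    { reflOn  = λ q → reflOn (Q⊆P q)
    ; symOn   = λ q₁ q₂ → symOn (Q⊆P q₁) (Q⊆P q₂)
    ; transOn = λ q₁ q₂ q₃ → transOn (Q⊆P q₁) (Q⊆P q₂) (Q⊆P q₃)
    }
    where open IsEquivOn isEquiv

  orbit⊆~-class : {S : Vec A n → Set ℓ} {_~_ : Vec A n → Vec A n → Set ℓ} →
                  IsEquivOn S _~_ → LeavesClassesInvariant G S _~_ →
                  ∀ {x a z} → S x → S a → x ~ a → InOrbit G x z → S z × z ~ a
  orbit⊆~-class {S} {_~_} isEquiv invariant {x} Sx Sa x~a (g , Gg , refl) =
    Sgx , IsEquivOn.transOn isEquiv Sgx Sx Sa gx~x x~a
    where
    Sgx : S (g · x)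
    Sgx = proj₁ (invariant Gg Sx)
    gx~x : (g · x) ~ x
    gx~x = proj₂ (invariant Gg Sx)

  orbit⊆η-class : IsPermGroup G → Primitive {n = n} G →
                  {S' : Vec A n → Set ℓ} {η : Vec A n → Vec A n → Set ℓ} →
                  IsEquivOn S' η → LeavesInvariant G S' η →
                  ∀ {x y z} → S' x → InOrbit G x y → Disjoint x y → η x y →
                  InOrbit G x z → η z x
  orbit⊆η-class isPermGroup isPrimitive {S'} {η} isEquiv (invS' , invη) {x} {y}
                S'x y∈Gx disjoint ηxy z∈Gx =
    isPrimitive x η onOrbit (λ Gg u∈Gx v∈Gx → invη Gg (inS' u∈Gx) (inS' v∈Gx))
      (x , y , x∈Gx , y∈Gx , disjoint , ηxy) z∈Gx x∈Gx
    where
    x∈Gx : InOrbit G x x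
    x∈Gx = InOrbit-refl isPermGroup x
    inS' : ∀ {u} → InOrbit G x u → S' u
    inS' = InOrbit-closed invS' S'x
    onOrbit : IsEquivOn (InOrbit G x) η
    onOrbit = IsEquivOn-restrict inS' isEquiv

lemma3p4 : ∀ {ℓ : Level} (A : Set ℓ) (n : ℕ) → 1 ≤ n →
    (S : Vec A n → Set ℓ) (_~_ : Vec A n → Vec A n → Set ℓ) → IsEquivOn S _~_ →
    (G : (A → A) → Set ℓ) → IsPermGroup G → Primitive {n = n} G →
    LeavesClassesInvariant G S _~_ →
    (S' : Vec A n → Set ℓ) (η : Vec A n → Vec A n → Set ℓ) →
    IsApproximation G S _~_ S' η → LeavesInvariant G S' η →
    Presmooth G S _~_ S' η → Smooth G S _~_ S' η
lemma3p4 A n _ S _~_ equiv~ G isPermGroup isPrimitive classesInvariant S' η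
         (_ , equivη , _) invariantη presmooth {a} Sa
  with presmooth Sa
... | c , S'c , x , y , (Sx , x~a , S'x , ηxc) , (_ , _ , S'y , ηyc) , disjoint , y∈Gx =
  c , S'c , x , λ z∈Gx → orbit⊆~-class G equiv~ classesInvariant Sx Sa x~a z∈Gx
                       , S'-orbit z∈Gx , η-orbit z∈Gx
  where
  open IsEquivOn equivη
  S'-orbit : ∀ {z} → InOrbit G x z → S' z
  S'-orbit = InOrbit-closed G (proj₁ invariantη) S'x
  ηxy : η x y
  ηxy = transOn S'x S'c S'y ηxc (symOn S'y S'c ηyc)
  η-orbit : ∀ {z} → InOrbit G x z → η z c
  η-orbit z∈Gx = transOn (S'-orbit z∈Gx) S'x S'c
    (orbit⊆η-class G isPermGroup isPrimitive equivη invariantη S'x y∈Gx disjoint ηxy z∈Gx)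
    ηxc
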